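{- Let $G$ be a finite graph with threshold weighting $\theta$, $n$ a positive integer, $A$ a join-tree over $G$, $S\subseteq V(G)$, and $\mathcal A\subseteq[n]^{V(A)\setminus S}$. Then for every $B\preceq A$, \[\chi_{B|S}\big(\pi_{V(B)\setminus S}(\mathcal A)\big)\ \le\ \chi_{A|S}(\mathcal A),\] where $\pi_U(\mathcal A)=\{x\in[n]^U:\exists y\in\mathcal A,\ y_U=x\}$ is the projection.
   Context: Graphs are simple; subgraphs have no isolated vertices. $\Delta_\theta(F)=|V(F)|-\sum_{e\in E(F)}\theta(e)$; a threshold weighting for finite $G$ is $\theta:E(G)\to[0,2]$ with $\Delta_\theta(F)\ge0$ for all $F\subseteq G$ and $\Delta_\theta(G)=0$. For $T\subseteq V(G)$, $F\ominus T$ is the union of the components of $F$ vertex-disjoint from $T$. Join-trees: finite rooted binary trees (non-leaf nodes have two ordered children) whose leaves are labeled by elements of $E(G)\cup\{\bot\}$; $\langle A\rangle$ is the subgraph formed by the edge labels, $V(A)=V(\langle A\rangle)$. $[B,C]$ is the join-tree with root children $B,C$; one-node join-trees are atomic. $D\preceq A$ if $D$ is the one-node $\bot$-labeled tree, or $D=A$, or $D\preceq$ a child of $A$. Relations: $\mu(\mathcal A)=|\mathcal A|/n^{|U|}$ for $\mathcal A\subseteq[n]^U$ ($[n]^\emptyset$ has one element); $x_U$ restricts tuple $x$ to coordinates $U$; $\mathcal B\bowtie\mathcal C=\{z\in[n]^{V\cup W}:z_V\in\mathcal B,z_W\in\mathcal C\}$; for $\mathcal A\subseteq[n]^V$, $z\in[n]^T$: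 $\rho_{V\setminus T}(\mathcal A,z)=\{x\in[n]^{V\setminus T}:\exists y\in\mathcal A,\ y_{V\setminus T}=x,\ y_{V\cap T}=z_{V\cap T}\}$. For $F\subseteq G$, $S\subseteq V(G)$: $\mathcal A\subseteq[n]^{V(F)\setminus S}$ is an $F|S$-pathset if $\mu(\rho_{V(F)\setminus T}(\mathcal A,z))\le n^{ -\Delta_\theta(F\ominus T)}$ for all $S\subseteq T\subseteq V(G)$, $z\in[n]^T$. Pathset complexity $\chi_{A|S}(\mathcal A)$ for $\mathcal A\subseteq[n]^{V(A)\setminus S}$: for atomic $A$, the minimum number of $\langle A\rangle|S$-pathsets whose union contains $\mathcal A$; for $A=[B,C]$, the minimum of $\sum_{i=1}^m\max\{\chi_{B|S}(\mathcal B_i),\chi_{C|S}(\mathcal C_i)\}$ over finite families $(\mathcal A_i,\mathcal B_i,\mathcal C_i)_{i\le m}$ of $\langle A\rangle|S$-, $\langle B\rangle|S$-, $\langle C\rangle|S$-pathsets with $\mathcal A_i\subseteq\mathcal B_i\bowtie\mathcal C_i$ and $\mathcal A\subseteq\bigcup_i\mathcal A_i$. -}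

module Defs where

open import Data.Bool using (Bool; true; false; _∧_; _∨_; not; if_then_else_)
open import Data.Nat as ℕ using (ℕ; zero; suc; _⊔_)
open import Data.Integer as ℤ using (ℤ; +_; -[1+_])
open import Data.Rational as ℚ using (ℚ; ↥_; ↧ₙ_; 0ℚ)
open import Data.Fin using (Fin; _≟_)
open import Data.Fin.Subset using (Subset; ⁅_⁆; _∪_; _∩_; _─_; ∣_∣; ⊤)
open import Data.Vec as Vec using (Vec; []; _∷_; lookup; tabulate)
import Data.Vec.Properties as VecP
open import Data.Maybe using (Maybe; just; nothing)
import Data.Maybe.Properties as MaybeP
open import Data.List as List using (List; [_]; concatMap; allFin; foldr)
open import Data.Bool.ListAction using (any)
open import Data.Product using (Σ; _×_; _,_; proj₁; proj₂; ∃)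
open import Data.Sum using (_⊎_)
open import Data.Unit using () renaming (⊤ to Unit)
open import Data.Empty using () renaming (⊥ to Empty)
open import Relation.Nullary using (¬_; does)
open import Relation.Binary.PropositionalEquality using (_≡_; _≢_)

-- Finite simple graphs: vertex set Fin v, edge set Fin m, each edge
-- given by its two (distinct) endpoints; no two edges share the same
-- unordered pair of endpoints.

record Graph : Set where
  field
    v        : ℕ
    m        : ℕ
    ends     : Fin m → Fin v × Fin v
    loopless : ∀ e → proj₁ (ends e) ≢ proj₂ (ends e)
    noMulti  : ∀ e f →
      ((proj₁ (ends e) ≡ proj₁ (ends f)) × (proj₂ (ends e) ≡ proj₂ (ends f)))
      ⊎ ((proj₁ (ends e) ≡ proj₂ (ends f)) × (proj₂ (ends e) ≡ proj₁ (ends f)))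
      → e ≡ f

-- Real numbers as (open, lower) Dedekind cuts of ℚ.

record ℝ : Set₁ where
  field
    L          : ℚ → Set
    inhabited  : ∃ λ q → L q
    bounded    : ∃ λ q → ¬ L q
    downClosed : ∀ {p q} → p ℚ.< q → L q → L p
    rounded    : ∀ {q} → L q → ∃ λ r → (q ℚ.< r) × L r
open ℝ public

-- comparisons of a real (given by its lower cut X) with a rational
_≤ℚ_ : (ℚ → Set) → ℚ → Set
X ≤ℚ r = ∀ q → X q → q ℚ.< r

_≥ℚ_ : (ℚ → Set) → ℚ → Set
X ≥ℚ r = ∀ q → q ℚ.< r → X q

ℕtoℚ : ℕ → ℚ
ℕtoℚ k = + k ℚ./ 1

ℤtoℚ : ℤ → ℚ
ℤtoℚ k = k ℚ./ 1

-- n ^ r < N  for rational r = p / q  (i.e. n^p < N^q, q > 0)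
powLt : ℕ → ℚ → ℕ → Set
powLt n r N with ↥ r
... | + a      = n ℕ.^ a ℕ.< N ℕ.^ (↧ₙ r)
... | -[1+ a ] = 1 ℕ.< N ℕ.^ (↧ₙ r) ℕ.* n ℕ.^ (suc a)

-- N ≤ n ^ (k + x), where the real x is given by its lower cut X
-- (for n ≥ 1: N ≤ n^y  iff  every rational r with n^r < N satisfies r < y)
PowLe : ℕ → ℕ → ℤ → (ℚ → Set) → Set
PowLe N n k X = ∀ r → powLt n r N → X (r ℚ.- ℤtoℚ k)

module _ (G : Graph) where
  open Graph G

  EdgeSet : Set
  EdgeSet = Subset m

  incident : Fin m → Fin v → Bool
  incident e i = does (i ≟ proj₁ (ends e)) ∨ does (i ≟ proj₂ (ends e))

  -- vertex set V(F) of the subgraph (without isolated vertices) with edge set F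
  Vx : EdgeSet → Subset v
  Vx F = tabulate λ i → any (λ e → lookup F e ∧ incident e i) (allFin m)

  step : EdgeSet → Subset v → Subset v
  step F R = tabulate λ i → lookup R i ∨
    any (λ e → lookup F e ∧ incident e i ∧
               (lookup R (proj₁ (ends e)) ∨ lookup R (proj₂ (ends e)))) (allFin m)

  iter : ℕ → EdgeSet → Subset v → Subset v
  iter zero    F R = R
  iter (suc k) F R = step F (iter k F R)

  -- vertices joined to T by a path in F (T itself included)
  reach : EdgeSet → Subset v → Subset v
  reach F T = iter v F T

  -- F ⊖ T : union of the components of F vertex-disjoint from T
  _⊖_ : EdgeSet → Subset v → EdgeSet
  F ⊖ T = tabulate λ e → lookup F e ∧
    not (lookup (reach F T) (proj₁ (ends e)) ∨ lookup (reach F T) (proj₂ (ends e)))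

  sumℚ : EdgeSet → (Fin m → ℚ) → ℚ
  sumℚ F qs = foldr (λ e acc → if lookup F e then qs e ℚ.+ acc else acc) 0ℚ (allFin m)

  -- lower cut of the real Σ_{e ∈ F} θ(e)
  SumL : (Fin m → ℝ) → EdgeSet → ℚ → Set
  SumL θ F q = ∃ λ (qs : Fin m → ℚ) → (∀ e → lookup F e ≡ true → L (θ e) (qs e))
                                     × (q ℚ.< sumℚ F qs)

  record ThresholdWeighting : Set₁ where
    field
      θ       : Fin m → ℝ
      θ≥0     : ∀ e → L (θ e) ≥ℚ 0ℚ
      θ≤2     : ∀ e → L (θ e) ≤ℚ ℕtoℚ 2
      -- Δ_θ(F) ≥ 0 for all F ⊆ G
      Δ≥0     : ∀ (F : EdgeSet) → SumL θ F ≤ℚ ℕtoℚ ∣ Vx F ∣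
      -- Δ_θ(G) = 0
      ΔG≤0    : SumL θ ⊤ ≥ℚ ℕtoℚ v
      ΔG≥0    : SumL θ ⊤ ≤ℚ ℕtoℚ v

  -- Join-trees; leaves labelled by an edge (just e) or ⊥ (nothing)

  data JT : Set where
    leaf : Maybe (Fin m) → JT
    node : JT → JT → JT

  ⟨_⟩ : JT → EdgeSet
  ⟨ leaf nothing  ⟩ = Data.Fin.Subset.⊥
  ⟨ leaf (just e) ⟩ = ⁅ e ⁆
  ⟨ node B C ⟩      = ⟨ B ⟩ ∪ ⟨ C ⟩

  VJ : JT → Subset v
  VJ A = Vx ⟨ A ⟩

  infix 4 _⪯_
  data _⪯_ : JT → JT → Set where
    ⪯⊥    : ∀ {A} → leaf nothing ⪯ A
    ⪯refl : ∀ {A} → A ⪯ A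
    ⪯left : ∀ {D B C} → D ⪯ B → D ⪯ node B C
    ⪯right : ∀ {D B C} → D ⪯ C → D ⪯ node B C

  -- A tuple in [n]^U (U ⊆ V(G)) is a vector over V(G) with
  -- `just` exactly at the coordinates in U.  A relation on U is a
  -- Boolean predicate, of which only the tuples in [n]^U matter.

  module _ (n : ℕ) where

    Tuple : Set
    Tuple = Vec (Maybe (Fin n)) v

    Rel : Set
    Rel = Tuple → Bool

    Dom : ∀ {k} → Subset k → Vec (Maybe (Fin n)) k → Set
    Dom []            []             = Unit
    Dom (false ∷ U)   (nothing ∷ x)  = Dom U x
    Dom (true ∷ U)    (just _ ∷ x)   = Dom U x
    Dom _             _              = Empty

    tuples : ∀ {k} → Subset k → List (Vec (Maybe (Fin n)) k)
    tuples []          = [ [] ]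
    tuples (false ∷ U) = List.map (nothing ∷_) (tuples U)
    tuples (true ∷ U)  = concatMap (λ x → List.map (λ a → just a ∷ x) (allFin n)) (tuples U)

    _≟ᵗ_ : (x y : Tuple) → _
    _≟ᵗ_ = VecP.≡-dec (MaybeP.≡-dec _≟_)

    restrict : Subset v → Tuple → Tuple
    restrict U x = Vec.zipWith (λ b a → if b then a else nothing) U x

    card : Subset v → Rel → ℕ
    card U 𝒜 = foldr (λ x acc → if 𝒜 x then suc acc else acc) 0 (tuples U)

    _⊆[_]_ : Rel → Subset v → Rel → Set
    𝒜 ⊆[ U ] ℬ = ∀ x → Dom U x → 𝒜 x ≡ true → ℬ x ≡ true

    ⋃ᴿ : ∀ {j} → (Fin j → Rel) → Rel
    ⋃ᴿ {j} fam x = any (λ i → fam i x) (allFin j)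

    join : Subset v → Subset v → Rel → Rel → Rel
    join V W ℬ 𝒞 z = ℬ (restrict V z) ∧ 𝒞 (restrict W z)

    proj : Subset v → Subset v → Rel → Rel
    proj U V 𝒜 x = any (λ y → 𝒜 y ∧ does (restrict U y ≟ᵗ x)) (tuples V)

    ρ : Subset v → Subset v → Rel → Tuple → Rel
    ρ V T 𝒜 z x = any (λ y → 𝒜 y ∧ does (restrict (V ─ T) y ≟ᵗ x)
                              ∧ does (restrict (V ∩ T) y ≟ᵗ restrict (V ∩ T) z))
                      (tuples V)

    module _ (tw : ThresholdWeighting) where
      open ThresholdWeighting tw

      IsPathset : EdgeSet → Subset v → Rel → Set
      IsPathset F S 𝒜 =
        ∀ (T : Subset v) → S Data.Fin.Subset.⊆ T → ∀ (z : Tuple) → Dom T z →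
          -- μ(ρ) ≤ n^{-Δ_θ(F⊖T)}, i.e. |ρ| ≤ n^{|V(F)∖T| - |V(F⊖T)| + Σ_{F⊖T} θ}
          PowLe (card ((Vx F ─ S) ─ T) (ρ (Vx F ─ S) T 𝒜 z)) n
                (+ ∣ Vx F ─ T ∣ ℤ.- + ∣ Vx (F ⊖ T) ∣)
                (SumL θ (F ⊖ T))

      sumℕ : ∀ {j} → (Fin j → ℕ) → ℕ
      sumℕ {j} f = foldr (λ i acc → f i ℕ.+ acc) 0 (allFin j)

      -- ChiLe A S 𝒜 k  :⇔  χ_{A|S}(𝒜) ≤ k   (χ being a minimum over ℕ)
      ChiLe : JT → Subset v → Rel → ℕ → Set
      ChiLe (leaf l) S 𝒜 k =
        ∃ λ j → (j ℕ.≤ k) × Σ (Fin j → Rel) λ fam →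
          (∀ i → IsPathset ⟨ leaf l ⟩ S (fam i)) × (𝒜 ⊆[ VJ (leaf l) ─ S ] ⋃ᴿ fam)
      ChiLe (node B C) S 𝒜 k =
        ∃ λ j → Σ (Fin j → Rel) λ 𝒜s → Σ (Fin j → Rel) λ ℬs → Σ (Fin j → Rel) λ 𝒞s →
        Σ (Fin j → ℕ) λ bs → Σ (Fin j → ℕ) λ cs →
          (∀ i → IsPathset ⟨ node B C ⟩ S (𝒜s i)
               × IsPathset ⟨ B ⟩ S (ℬs i)
               × IsPathset ⟨ C ⟩ S (𝒞s i)
               × (𝒜s i ⊆[ VJ (node B C) ─ S ] join (VJ B ─ S) (VJ C ─ S) (ℬs i) (𝒞s i))
               × ChiLe B S (ℬs i) (bs i)
               × ChiLe C S (𝒞s i) (cs i))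
          × (𝒜 ⊆[ VJ (node B C) ─ S ] ⋃ᴿ 𝒜s)
          × (sumℕ (λ i → bs i ⊔ cs i) ℕ.≤ k)

module Submission where

-- A bound χ_{A|S}(𝒜) ≤ k is a cover of 𝒜 by pieces of total cost at most k,
-- so χ is monotone under inclusion and subadditive under finite unions. If A = [B′,C] with
-- witnessing triples 𝒜ᵢ ⊆ ℬᵢ ⋈ 𝒞ᵢ, then π_{B′}(𝒜) ⊆ ⋃ᵢ ℬᵢ, hence
-- χ_{B′}(π_{B′} 𝒜) ≤ Σᵢ χ(ℬᵢ) ≤ Σᵢ max(χ(ℬᵢ), χ(𝒞ᵢ)) ≤ k; as π_B factors through π_{B′} for
-- B ⪯ B′, induction applies. For the ⊥-leaf, V(⊥) = ∅ and
-- the whole of [n]^∅ is a single ⊥|S-pathset of cost 1, which is affordable unless k = 0, in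
-- which case 𝒜, and with it its projection, is empty.

open import Defs
open import Data.Nat using (ℕ; _≤_)
open import Data.Fin.Subset using (Subset; _─_)

open import Data.Bool using (Bool; true; false; _∧_; if_then_else_)
open import Data.Bool.Properties using (T-≡)
open import Data.Nat using (zero; suc; _+_; _⊔_; _^_; z≤n; s≤s)
import Data.Nat.Properties as ℕ
import Data.Integer as ℤ
open import Data.Rational as ℚ using (mkℚ; 0ℚ)
import Data.Rational.Properties as ℚ
open import Data.Fin using (Fin; zero; suc; _↑ˡ_; _↑ʳ_; splitAt)
open import Data.Fin.Subset using (⊥; _⊆_; _∈_; _∉_)
open import Data.Fin.Subset.Properties
  using ( drop-∷-⊆; x∈p∧x∉q⇒x∈p─q; ∉⊥; ⊥⊆; ⊆-refl; ⊆-trans; ⊆-antisym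
        ; p⊆p∪q; q⊆p∪q; p─q⊆p; ∣⊥∣≡0 )
open import Data.Vec as Vec using (Vec; []; _∷_; here; there; lookup)
open import Data.Vec.Properties using (lookup∘tabulate; lookup-replicate; []=⇒lookup; lookup⇒[]=)
open import Data.Vec.Functional using (_++_)
open import Data.Vec.Functional.Properties using (lookup-++ˡ; lookup-++ʳ)
open import Data.Maybe using (Maybe; just; nothing)
open import Data.List as List using (List; [_]; allFin; foldr)
import Data.List.Properties as List
open import Data.Bool.ListAction using (any)
open import Data.List.Relation.Unary.Any.Properties using (any⁺; any⁻)
open import Data.List.Membership.Propositional using (find; lose) renaming (_∈_ to _∈ˡ_)
open import Data.List.Membership.Propositional.Properties
  using (∈-allFin; ∈-map⁺; ∈-map⁻; ∈-concatMap⁺; ∈-concatMap⁻)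
import Data.List.Relation.Unary.Any as Any
open import Data.Product using (Σ; _×_; _,_; proj₁; proj₂; ∃)
open import Data.Sum using (_⊎_; inj₁; inj₂)
open import Data.Unit using (tt)
open import Function using (_∘_; Equivalence)
open import Relation.Nullary using (contradiction)
open import Relation.Nullary.Decidable using (toWitness; dec-true; isYes≗does)
open import Relation.Binary.PropositionalEquality
  using (_≡_; _≗_; refl; sym; trans; cong; cong₂; subst; module ≡-Reasoning)

module _ {A : Set} where

  any-true⁻ : (p : A → Bool) (xs : List A) → any p xs ≡ true →
    ∃ λ x → x ∈ˡ xs × p x ≡ true
  any-true⁻ p xs eq with find (any⁻ p xs (Equivalence.from T-≡ eq))
  ... | x , x∈xs , px = x , x∈xs , Equivalence.to T-≡ px

  any-true⁺ : (p : A → Bool) {xs : List A} {x : A} → x ∈ˡ xs → p x ≡ true → any p xs ≡ true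
  any-true⁺ p x∈xs px = Equivalence.to T-≡ (any⁺ p (lose x∈xs (Equivalence.from T-≡ px)))

∧-true⁻ : ∀ {x y} → x ∧ y ≡ true → x ≡ true × y ≡ true
∧-true⁻ {true} {true} _ = refl , refl

-- Defs.sumℕ without its unused graph parameters (the two are definitionally equal).
∑ : ∀ {j} → (Fin j → ℕ) → ℕ
∑ {j} f = foldr (λ i acc → f i + acc) 0 (allFin j)

∑-suc : ∀ {j} (f : Fin (suc j) → ℕ) → ∑ f ≡ f zero + ∑ (f ∘ suc)
∑-suc {j} f = cong (f zero +_) (begin
  foldr (λ i acc → f i + acc) 0 (List.tabulate suc)
    ≡⟨ cong (foldr _ 0) (List.map-tabulate {n = j} (λ i → i) suc) ⟨
  foldr (λ i acc → f i + acc) 0 (List.map suc (allFin j))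
    ≡⟨ List.foldr-map _ suc 0 (allFin j) ⟩
  ∑ (f ∘ suc)
    ∎)
  where open ≡-Reasoning

∑-cong : ∀ {j} {f g : Fin j → ℕ} → f ≗ g → ∑ f ≡ ∑ g
∑-cong {j} f≗g = List.foldr-cong (λ i acc → cong (_+ acc) (f≗g i)) refl (allFin j)

∑-mono : ∀ {j} {f g : Fin j → ℕ} → (∀ i → f i ≤ g i) → ∑ f ≤ ∑ g
∑-mono {zero} _ = z≤n
∑-mono {suc j} {f} {g} f≤g rewrite ∑-suc f | ∑-suc g =
  ℕ.+-mono-≤ (f≤g zero) (∑-mono (f≤g ∘ suc))

≤-∑ : ∀ {j} (f : Fin j → ℕ) i → f i ≤ ∑ f
≤-∑ f zero    rewrite ∑-suc f = ℕ.m≤m+n _ _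
≤-∑ f (suc i) rewrite ∑-suc f = ℕ.≤-trans (≤-∑ (f ∘ suc) i) (ℕ.m≤n+m _ _)

∑-++ : ∀ {A : Set} {j₁ j₂} (h : A → ℕ) (f : Fin j₁ → A) (g : Fin j₂ → A) →
  ∑ (h ∘ (f ++ g)) ≡ ∑ (h ∘ f) + ∑ (h ∘ g)
∑-++ {j₁ = zero}   h f g = refl
∑-++ {j₁ = suc j₁} h f g = begin
  ∑ (h ∘ (f ++ g))                         ≡⟨ ∑-suc (h ∘ (f ++ g)) ⟩
  h (f zero) + ∑ (h ∘ (f ++ g) ∘ suc)      ≡⟨ cong (h (f zero) +_) (∑-cong tail-++) ⟩
  h (f zero) + ∑ (h ∘ ((f ∘ suc) ++ g))    ≡⟨ cong (h (f zero) +_) (∑-++ h (f ∘ suc) g) ⟩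
  h (f zero) + (∑ (h ∘ f ∘ suc) + ∑ (h ∘ g)) ≡⟨ ℕ.+-assoc (h (f zero)) _ _ ⟨
  h (f zero) + ∑ (h ∘ f ∘ suc) + ∑ (h ∘ g)   ≡⟨ cong (_+ ∑ (h ∘ g)) (∑-suc (h ∘ f)) ⟨
  ∑ (h ∘ f) + ∑ (h ∘ g)                    ∎
  where
  open ≡-Reasoning
  tail-++ : h ∘ (f ++ g) ∘ suc ≗ h ∘ ((f ∘ suc) ++ g)
  tail-++ i with splitAt j₁ i
  ... | inj₁ _ = refl
  ... | inj₂ _ = refl

∑-1 : ∀ j → ∑ {j} (λ _ → 1) ≡ j
∑-1 zero    = refl
∑-1 (suc j) = trans (∑-suc {j} (λ _ → 1)) (cong suc (∑-1 j))

powLt-negative : ∀ {n N} r → 1 ≤ n → N ≤ 1 → powLt n r N → r ℚ.< 0ℚ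
powLt-negative {n} {N} (mkℚ (ℤ.+ a) d _) 1≤n N≤1 nᵃ<Nᵈ =
  contradiction Nᵈ≤nᵃ (ℕ.<⇒≱ nᵃ<Nᵈ)
  where
  open ℕ.≤-Reasoning
  Nᵈ≤nᵃ : N ^ suc d ≤ n ^ a
  Nᵈ≤nᵃ = begin
    N ^ suc d  ≤⟨ ℕ.^-monoˡ-≤ (suc d) N≤1 ⟩
    1 ^ suc d  ≡⟨ ℕ.^-zeroˡ (suc d) ⟩
    1          ≡⟨ ℕ.^-zeroˡ a ⟨
    1 ^ a      ≤⟨ ℕ.^-monoˡ-≤ a 1≤n ⟩
    n ^ a      ∎
powLt-negative r@(mkℚ ℤ.-[1+ _ ] _ _) _ _ _ = ℚ.negative⁻¹ r

-- Defs.restrict, at every length.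
mask : ∀ {A : Set} {k} → Subset k → Vec (Maybe A) k → Vec (Maybe A) k
mask U x = Vec.zipWith (λ b a → if b then a else nothing) U x

mask-mask : ∀ {A : Set} {k} {U W : Subset k} → U ⊆ W → (x : Vec (Maybe A) k) →
  mask U (mask W x) ≡ mask U x
mask-mask {U = []}        {[]}        _   []      = refl
mask-mask {U = false ∷ U} {_ ∷ W}     U⊆W (_ ∷ x) =
  cong (nothing ∷_) (mask-mask (drop-∷-⊆ U⊆W) x)
mask-mask {U = true ∷ U}  {true ∷ W}  U⊆W (a ∷ x) =
  cong (a ∷_) (mask-mask (drop-∷-⊆ U⊆W) x)
mask-mask {U = true ∷ U}  {false ∷ W} U⊆W _ with U⊆W here
... | ()

∈─⇒∉ : ∀ {k} {i : Fin k} (U T : Subset k) → i ∈ U ─ T → i ∉ T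
∈─⇒∉ (true ∷ U) (false ∷ T) here ()
∈─⇒∉ (_ ∷ U) (_ ∷ T) (there i∈U─T) (there i∈T) = ∈─⇒∉ U T i∈U─T i∈T

─-monoˡ : ∀ {k} {U W : Subset k} (T : Subset k) → U ⊆ W → U ─ T ⊆ W ─ T
─-monoˡ {U = U} T U⊆W i∈U─T =
  x∈p∧x∉q⇒x∈p─q (U⊆W (p─q⊆p U T i∈U─T)) (∈─⇒∉ U T i∈U─T)

⊥─ : ∀ {k} (T : Subset k) → ⊥ ─ T ≡ ⊥
⊥─ T = ⊆-antisym (p─q⊆p ⊥ T) ⊥⊆

module _ (G : Graph) where
  open Graph G

  ∈-Vx⁻ : ∀ {F i} → i ∈ Vx G F → ∃ λ e → e ∈ F × incident G e i ≡ true
  ∈-Vx⁻ {F} {i} i∈VF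
    with any-true⁻ _ (allFin m) (trans (sym (lookup∘tabulate _ i)) ([]=⇒lookup i∈VF))
  ... | e , _ , Fe∧inc with ∧-true⁻ {lookup F e} Fe∧inc
  ... | Fe , inc = e , lookup⇒[]= e F Fe , inc

  ∈-Vx⁺ : ∀ {F i e} → e ∈ F → incident G e i ≡ true → i ∈ Vx G F
  ∈-Vx⁺ {F} {i} {e} e∈F inc = lookup⇒[]= i (Vx G F) (trans (lookup∘tabulate _ i)
    (any-true⁺ (λ e → lookup F e ∧ incident G e i) (∈-allFin e)
      (subst (λ b → b ∧ incident G e i ≡ true) (sym ([]=⇒lookup e∈F)) inc)))

  Vx-mono : ∀ {F F'} → F ⊆ F' → Vx G F ⊆ Vx G F'
  Vx-mono F⊆F' i∈VF with ∈-Vx⁻ i∈VF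
  ... | e , e∈F , inc = ∈-Vx⁺ (F⊆F' e∈F) inc

  Vx-⊥ : Vx G ⊥ ≡ ⊥
  Vx-⊥ = ⊆-antisym (λ i∈V⊥ → contradiction (proj₁ (proj₂ (∈-Vx⁻ i∈V⊥))) ∉⊥) ⊥⊆

  ⊖-⊆ : ∀ F T → _⊖_ G F T ⊆ F
  ⊖-⊆ F T {e} e∈F⊖T = lookup⇒[]= e F
    (proj₁ (∧-true⁻ {lookup F e} (trans (sym (lookup∘tabulate _ e)) ([]=⇒lookup e∈F⊖T))))

  ⊥⊖ : ∀ T → _⊖_ G ⊥ T ≡ ⊥
  ⊥⊖ T = ⊆-antisym (⊖-⊆ ⊥ T) ⊥⊆

  sumℚ-⊥ : ∀ qs → sumℚ G ⊥ qs ≡ 0ℚ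
  sumℚ-⊥ qs = sym (List.foldr-universal (λ _ → 0ℚ) _ 0ℚ refl skip (allFin m))
    where
    skip : ∀ e acc → 0ℚ ≡ (if lookup ⊥ e then qs e ℚ.+ 0ℚ else 0ℚ)
    skip e _ rewrite lookup-replicate e false = refl

  SumL-⊥ : ∀ θ {q} → q ℚ.< 0ℚ → SumL G θ ⊥ q
  SumL-⊥ θ q<0 = (λ _ → 0ℚ) , (λ e e∈⊥ → contradiction (lookup⇒[]= e ⊥ e∈⊥) ∉⊥) ,
                 subst (_ ℚ.<_) (sym (sumℚ-⊥ (λ _ → 0ℚ))) q<0

  ⟨⟩-mono : ∀ {D A} → _⪯_ G D A → ⟨_⟩ G D ⊆ ⟨_⟩ G A
  ⟨⟩-mono ⪯⊥                   = ⊥⊆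
  ⟨⟩-mono ⪯refl                = ⊆-refl
  ⟨⟩-mono (⪯left  {C = C} D⪯B) = ⊆-trans (⟨⟩-mono D⪯B) (p⊆p∪q (⟨_⟩ G C))
  ⟨⟩-mono (⪯right {B = B} D⪯C) = ⊆-trans (⟨⟩-mono D⪯C) (q⊆p∪q (⟨_⟩ G B) _)

  VJ─-mono : ∀ {D A} (S : Subset v) → _⪯_ G D A → VJ G D ─ S ⊆ VJ G A ─ S
  VJ─-mono S D⪯A = ─-monoˡ S (Vx-mono (⟨⟩-mono D⪯A))

  VJ─-⊆ˡ : ∀ (S : Subset v) B C → VJ G B ─ S ⊆ VJ G (node B C) ─ S
  VJ─-⊆ˡ S B C = VJ─-mono S (⪯left {B = B} {C} ⪯refl)

  VJ─-⊆ʳ : ∀ (S : Subset v) B C → VJ G C ─ S ⊆ VJ G (node B C) ─ S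
  VJ─-⊆ʳ S B C = VJ─-mono S (⪯right {B = B} {C} ⪯refl)

  module _ (n : ℕ) where

    infix 4 _⊆ᴿ[_]_
    _⊆ᴿ[_]_ : Rel G n → Subset v → Rel G n → Set
    𝒜 ⊆ᴿ[ U ] ℬ = _⊆[_]_ G n 𝒜 U ℬ

    ⊆ᴿ-trans : ∀ {U 𝒜 ℬ 𝒞} → 𝒜 ⊆ᴿ[ U ] ℬ → ℬ ⊆ᴿ[ U ] 𝒞 → 𝒜 ⊆ᴿ[ U ] 𝒞
    ⊆ᴿ-trans 𝒜⊆ℬ ℬ⊆𝒞 x d 𝒜x = ℬ⊆𝒞 x d (𝒜⊆ℬ x d 𝒜x)

    Dom-mask : ∀ {k} {U W : Subset k} {x} → U ⊆ W → Dom G n W x → Dom G n U (mask U x)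
    Dom-mask {U = []}        {[]}        {[]}         _   _ = tt
    Dom-mask {U = false ∷ U} {false ∷ W} {nothing ∷ x} U⊆W d = Dom-mask (drop-∷-⊆ U⊆W) d
    Dom-mask {U = false ∷ U} {true ∷ W}  {just _ ∷ x}  U⊆W d = Dom-mask (drop-∷-⊆ U⊆W) d
    Dom-mask {U = true ∷ U}  {true ∷ W}  {just _ ∷ x}  U⊆W d = Dom-mask (drop-∷-⊆ U⊆W) d
    Dom-mask {U = true ∷ U}  {false ∷ W}               U⊆W _ with U⊆W here
    ... | ()

    mask-Dom : ∀ {k} {U : Subset k} {x} → Dom G n U x → mask U x ≡ x
    mask-Dom {U = []}        {[]}         _ = refl
    mask-Dom {U = false ∷ U} {nothing ∷ x} d = cong (nothing ∷_) (mask-Dom d)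
    mask-Dom {U = true ∷ U}  {just a ∷ x}  d = cong (just a ∷_) (mask-Dom d)

    extensions : ∀ {k} → Vec (Maybe (Fin n)) k → List (Vec (Maybe (Fin n)) (suc k))
    extensions x = List.map (λ a → just a ∷ x) (allFin n)

    ∈-tuples⁺ : ∀ {k} (U : Subset k) {x} → Dom G n U x → x ∈ˡ tuples G n U
    ∈-tuples⁺ []          {[]}          _ = Any.here refl
    ∈-tuples⁺ (false ∷ U) {nothing ∷ x} d = ∈-map⁺ (nothing ∷_) (∈-tuples⁺ U d)
    ∈-tuples⁺ (true ∷ U)  {just a ∷ x}  d =
      ∈-concatMap⁺ extensions (lose (∈-tuples⁺ U d) (∈-map⁺ (λ b → just b ∷ x) (∈-allFin a)))

    ∈-tuples⁻ : ∀ {k} (U : Subset k) {x} → x ∈ˡ tuples G n U → Dom G n U x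
    ∈-tuples⁻ []          (Any.here refl) = tt
    ∈-tuples⁻ (false ∷ U) x∈ with ∈-map⁻ (nothing ∷_) x∈
    ... | _ , y∈ , refl = ∈-tuples⁻ U y∈
    ∈-tuples⁻ (true ∷ U)  x∈ with find (∈-concatMap⁻ extensions {xs = tuples G n U} x∈)
    ... | y , y∈ , x∈ys with ∈-map⁻ (λ a → just a ∷ y) x∈ys
    ... | _ , _ , refl = ∈-tuples⁻ U y∈

    tuples-⊥ : ∀ k → tuples G n (⊥ {k}) ≡ [ Vec.replicate k nothing ]
    tuples-⊥ zero    = refl
    tuples-⊥ (suc k) rewrite tuples-⊥ k = refl

    card-⊥≤1 : ∀ R → card G n ⊥ R ≤ 1
    card-⊥≤1 R rewrite tuples-⊥ v with R (Vec.replicate v nothing)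
    ... | true  = s≤s z≤n
    ... | false = z≤n

    ⋃ᴿ-true⁻ : ∀ {j} (𝒜s : Fin j → Rel G n) {x} → ⋃ᴿ G n 𝒜s x ≡ true →
      ∃ λ i → 𝒜s i x ≡ true
    ⋃ᴿ-true⁻ {j} _ eq with any-true⁻ _ (allFin j) eq
    ... | i , _ , 𝒜ᵢx = i , 𝒜ᵢx

    ⋃ᴿ-true⁺ : ∀ {j} (𝒜s : Fin j → Rel G n) {x} i → 𝒜s i x ≡ true → ⋃ᴿ G n 𝒜s x ≡ true
    ⋃ᴿ-true⁺ 𝒜s {x} i = any-true⁺ (λ i → 𝒜s i x) (∈-allFin i)

    proj-witness : ∀ U W {𝒜 x} → proj G n U W 𝒜 x ≡ true →
      ∃ λ y → Dom G n W y × 𝒜 y ≡ true × restrict G n U y ≡ x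
    proj-witness U W {𝒜} {x} eq with any-true⁻ _ (tuples G n W) eq
    ... | y , y∈ , 𝒜y∧Uy≡x with ∧-true⁻ {𝒜 y} 𝒜y∧Uy≡x
    ... | 𝒜y , Uy≡x = y , ∈-tuples⁻ W y∈ , 𝒜y ,
      toWitness (Equivalence.from T-≡ (trans (isYes≗does (_≟ᵗ_ G n (restrict G n U y) x)) Uy≡x))

    proj-intro : ∀ U W {𝒜 y} → Dom G n W y → 𝒜 y ≡ true →
      proj G n U W 𝒜 (restrict G n U y) ≡ true
    proj-intro U W {𝒜} {y} dy 𝒜y = any-true⁺ _ (∈-tuples⁺ W dy)
      (cong₂ _∧_ 𝒜y (dec-true (_≟ᵗ_ G n (restrict G n U y) (restrict G n U y)) refl))

    proj-⊆-self : ∀ V {𝒜} → proj G n V V 𝒜 ⊆ᴿ[ V ] 𝒜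
    proj-⊆-self V {𝒜} x _ r with proj-witness V V r
    ... | y , dy , 𝒜y , Vy≡x = subst (λ z → 𝒜 z ≡ true) (trans (sym (mask-Dom dy)) Vy≡x) 𝒜y

    proj-∘ : ∀ {U V W 𝒜} → U ⊆ V → V ⊆ W →
      proj G n U W 𝒜 ⊆ᴿ[ U ] proj G n U V (proj G n V W 𝒜)
    proj-∘ {U} {V} {W} {𝒜} U⊆V V⊆W x _ r with proj-witness U W r
    ... | y , dy , 𝒜y , Uy≡x =
      subst (λ z → proj G n U V (proj G n V W 𝒜) z ≡ true) (trans (mask-mask U⊆V y) Uy≡x)
        (proj-intro U V (Dom-mask V⊆W dy) (proj-intro V W dy 𝒜y))

    proj-⊆-⋃ : ∀ V W {j 𝒜} {𝒜s ℬs : Fin j → Rel G n} → 𝒜 ⊆ᴿ[ W ] ⋃ᴿ G n 𝒜s →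
      (∀ i → 𝒜s i ⊆ᴿ[ W ] ℬs i ∘ restrict G n V) → proj G n V W 𝒜 ⊆ᴿ[ V ] ⋃ᴿ G n ℬs
    proj-⊆-⋃ V W {𝒜s = 𝒜s} {ℬs} 𝒜⊆⋃𝒜s 𝒜ᵢ⊆ℬᵢ x _ r with proj-witness V W r
    ... | y , dy , 𝒜y , Vy≡x with ⋃ᴿ-true⁻ 𝒜s (𝒜⊆⋃𝒜s y dy 𝒜y)
    ... | i , 𝒜ᵢy =
      ⋃ᴿ-true⁺ ℬs i (subst (λ z → ℬs i z ≡ true) Vy≡x (𝒜ᵢ⊆ℬᵢ i y dy 𝒜ᵢy))

    module Covering {P : Set} (rel : P → Rel G n) (cost : P → ℕ) (U : Subset v) where

      record Cover (𝒜 : Rel G n) (k : ℕ) : Set where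
        constructor cover
        field
          size    : ℕ
          piece   : Fin size → P
          covers  : 𝒜 ⊆ᴿ[ U ] ⋃ᴿ G n (rel ∘ piece)
          bounded : ∑ (cost ∘ piece) ≤ k

      weaken : ∀ {𝒜 k l} → k ≤ l → Cover 𝒜 k → Cover 𝒜 l
      weaken k≤l (cover j f c b) = cover j f c (ℕ.≤-trans b k≤l)

      shrink : ∀ {ℛ 𝒜 k} → ℛ ⊆ᴿ[ U ] 𝒜 → Cover 𝒜 k → Cover ℛ k
      shrink ℛ⊆𝒜 (cover j f c b) = cover j f (⊆ᴿ-trans {U} ℛ⊆𝒜 c) b

      covering-piece : ∀ {𝒜 k x} → Cover 𝒜 k → Dom G n U x → 𝒜 x ≡ true →
        ∃ λ p → rel p x ≡ true × cost p ≤ k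
      covering-piece (cover j f c b) d 𝒜x with ⋃ᴿ-true⁻ (rel ∘ f) (c _ d 𝒜x)
      ... | i , e = f i , e , ℕ.≤-trans (≤-∑ (cost ∘ f) i) b

      union : ∀ {ℛ 𝒜 ℬ k l} → Cover 𝒜 k → Cover ℬ l →
        (∀ x → Dom G n U x → ℛ x ≡ true → 𝒜 x ≡ true ⊎ ℬ x ≡ true) → Cover ℛ (k + l)
      union {ℛ} {k = k} {l} (cover j₁ f₁ c₁ b₁) (cover j₂ f₂ c₂ b₂) ℛ⊆𝒜∪ℬ =
        cover (j₁ + j₂) (f₁ ++ f₂) covers
          (subst (_≤ k + l) (sym (∑-++ cost f₁ f₂)) (ℕ.+-mono-≤ b₁ b₂))
        where
        covers : ℛ ⊆ᴿ[ U ] ⋃ᴿ G n (rel ∘ (f₁ ++ f₂))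
        covers x d ℛx with ℛ⊆𝒜∪ℬ x d ℛx
        ... | inj₁ 𝒜x with ⋃ᴿ-true⁻ (rel ∘ f₁) (c₁ x d 𝒜x)
        ... | i , e = ⋃ᴿ-true⁺ (rel ∘ (f₁ ++ f₂)) (i ↑ˡ j₂)
                        (subst (λ p → rel p x ≡ true) (sym (lookup-++ˡ f₁ f₂ i)) e)
        covers x d ℛx | inj₂ ℬx with ⋃ᴿ-true⁻ (rel ∘ f₂) (c₂ x d ℬx)
        ... | i , e = ⋃ᴿ-true⁺ (rel ∘ (f₁ ++ f₂)) (j₁ ↑ʳ i)
                        (subst (λ p → rel p x ≡ true) (sym (lookup-++ʳ f₁ f₂ i)) e)

      ⋃ : ∀ {j} {𝒜s : Fin j → Rel G n} {ks : Fin j → ℕ} →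
        (∀ i → Cover (𝒜s i) (ks i)) → Cover (⋃ᴿ G n 𝒜s) (∑ ks)
      ⋃ {zero}          _    = cover 0 (λ ()) (λ _ _ ()) z≤n
      ⋃ {suc j} {𝒜s} {ks} covs =
        subst (Cover _) (sym (∑-suc ks)) (union (covs zero) (⋃ (covs ∘ suc)) split)
        where
        split : ∀ x → Dom G n U x → ⋃ᴿ G n 𝒜s x ≡ true →
          𝒜s zero x ≡ true ⊎ ⋃ᴿ G n (𝒜s ∘ suc) x ≡ true
        split x _ r with ⋃ᴿ-true⁻ 𝒜s r
        ... | zero  , e = inj₁ e
        ... | suc i , e = inj₂ (⋃ᴿ-true⁺ (𝒜s ∘ suc) i e)

    module _ (tw : ThresholdWeighting G) where
      open ThresholdWeighting tw using (θ)

      -- V(∅) = ∅, so [n]^∅ has a single tuple and the required bound is n^{-Δ(∅)} = 1.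
      IsPathset-⊥ : 1 ≤ n → ∀ S 𝒜 → IsPathset G n tw ⊥ S 𝒜
      IsPathset-⊥ 1≤n S _ T _ _ _ rewrite ⊥⊖ T | Vx-⊥ | ⊥─ S | ⊥─ T | ∣⊥∣≡0 v =
        λ r nʳ<N → SumL-⊥ θ (subst (ℚ._< 0ℚ) (sym (ℚ.+-identityʳ r))
                              (powLt-negative r 1≤n (card-⊥≤1 _) nʳ<N))

      module _ (S : Subset v) where

        record Junction (B C : JT G) : Set where
          constructor junction
          field
            rel left right : Rel G n
            lcost rcost    : ℕ
            rel-pathset    : IsPathset G n tw (⟨_⟩ G (node B C)) S rel
            left-pathset   : IsPathset G n tw (⟨_⟩ G B) S left
            right-pathset  : IsPathset G n tw (⟨_⟩ G C) S right
            rel⊆join       : rel ⊆ᴿ[ VJ G (node B C) ─ S ]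
                               join G n (VJ G B ─ S) (VJ G C ─ S) left right
            left-χ         : ChiLe G n tw B S left lcost
            right-χ        : ChiLe G n tw C S right rcost

        -- The pieces of the cover χ_{A|S}(𝒜) ≤ k: ⟨A⟩|S-pathsets of cost 1 at a leaf, and at
        -- A = [B,C] the triples 𝒜ᵢ ⊆ ℬᵢ ⋈ 𝒞ᵢ of cost max(χ_B ℬᵢ, χ_C 𝒞ᵢ).
        Piece : JT G → Set
        Piece (leaf l)   = Σ (Rel G n) (IsPathset G n tw (⟨_⟩ G (leaf l)) S)
        Piece (node B C) = Junction B C

        pieceRel : ∀ A → Piece A → Rel G n
        pieceRel (leaf _)   = proj₁
        pieceRel (node _ _) = Junction.rel

        pieceCost : ∀ A → Piece A → ℕ
        pieceCost (leaf _)   _ = 1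
        pieceCost (node _ _) p = Junction.lcost p ⊔ Junction.rcost p

        module CoverOf (A : JT G) = Covering (pieceRel A) (pieceCost A) (VJ G A ─ S)

        toCover : ∀ A {𝒜 k} → ChiLe G n tw A S 𝒜 k → CoverOf.Cover A 𝒜 k
        toCover (leaf l) {k = k} (j , j≤k , fam , pathsets , c) =
          CoverOf.cover {leaf l} j (λ i → fam i , pathsets i) c (subst (_≤ k) (sym (∑-1 j)) j≤k)
        toCover (node B C) (j , 𝒜s , ℬs , 𝒞s , bs , cs , valid , c , b) =
          CoverOf.cover {node B C} j junctionᵢ c b
          where
          junctionᵢ : Fin j → Junction B C
          junctionᵢ i = let (p𝒜 , pℬ , p𝒞 , ⊆join , χℬ , χ𝒞) = valid i in
            junction (𝒜s i) (ℬs i) (𝒞s i) (bs i) (cs i) p𝒜 pℬ p𝒞 ⊆join χℬ χ𝒞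

        fromCover : ∀ A {𝒜 k} → CoverOf.Cover A 𝒜 k → ChiLe G n tw A S 𝒜 k
        fromCover (leaf l) {k = k} (CoverOf.cover j f c b) =
          j , subst (_≤ k) (∑-1 j) b , proj₁ ∘ f , proj₂ ∘ f , c
        fromCover (node B C) (CoverOf.cover j f c b) =
          j , rel ∘ f , left ∘ f , right ∘ f , lcost ∘ f , rcost ∘ f ,
          (λ i → rel-pathset (f i) , left-pathset (f i) , right-pathset (f i) ,
                 rel⊆join (f i) , left-χ (f i) , right-χ (f i)) ,
          c , b
          where open Junction

        ChiLe-⊆ : ∀ A {ℛ 𝒜 k} → ℛ ⊆ᴿ[ VJ G A ─ S ] 𝒜 →
          ChiLe G n tw A S 𝒜 k → ChiLe G n tw A S ℛ k
        ChiLe-⊆ A ℛ⊆𝒜 = fromCover A ∘ CoverOf.shrink A ℛ⊆𝒜 ∘ toCover A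

        ChiLe-weaken : ∀ A {𝒜 k l} → k ≤ l → ChiLe G n tw A S 𝒜 k → ChiLe G n tw A S 𝒜 l
        ChiLe-weaken A k≤l = fromCover A ∘ CoverOf.weaken A k≤l ∘ toCover A

        ChiLe-⋃ : ∀ A {j} {𝒜s : Fin j → Rel G n} {ks : Fin j → ℕ} →
          (∀ i → ChiLe G n tw A S (𝒜s i) (ks i)) → ChiLe G n tw A S (⋃ᴿ G n 𝒜s) (∑ ks)
        ChiLe-⋃ A χs = fromCover A (CoverOf.⋃ A (toCover A ∘ χs))

        ChiLe-projˡ : ∀ {B C 𝒜 k} → ChiLe G n tw (node B C) S 𝒜 k →
          ChiLe G n tw B S (proj G n (VJ G B ─ S) (VJ G (node B C) ─ S) 𝒜) k
        ChiLe-projˡ {B} {C} {𝒜} {k} χ with toCover (node B C) χ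
        ... | CoverOf.cover j f c b =
          ChiLe-⊆ B π⊆⋃left (ChiLe-weaken B ∑lcost≤k (ChiLe-⋃ B (left-χ ∘ f)))
          where
          open Junction
          π⊆⋃left : proj G n (VJ G B ─ S) (VJ G (node B C) ─ S) 𝒜
                      ⊆ᴿ[ VJ G B ─ S ] ⋃ᴿ G n (left ∘ f)
          π⊆⋃left = proj-⊆-⋃ (VJ G B ─ S) (VJ G (node B C) ─ S) c
                      (λ i y d r → proj₁ (∧-true⁻ (rel⊆join (f i) y d r)))
          ∑lcost≤k : ∑ (lcost ∘ f) ≤ k
          ∑lcost≤k = ℕ.≤-trans (∑-mono (λ i → ℕ.m≤m⊔n (lcost (f i)) (rcost (f i)))) b

        ChiLe-projʳ : ∀ {B C 𝒜 k} → ChiLe G n tw (node B C) S 𝒜 k →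
          ChiLe G n tw C S (proj G n (VJ G C ─ S) (VJ G (node B C) ─ S) 𝒜) k
        ChiLe-projʳ {B} {C} {𝒜} {k} χ with toCover (node B C) χ
        ... | CoverOf.cover j f c b =
          ChiLe-⊆ C π⊆⋃right (ChiLe-weaken C ∑rcost≤k (ChiLe-⋃ C (right-χ ∘ f)))
          where
          open Junction
          π⊆⋃right : proj G n (VJ G C ─ S) (VJ G (node B C) ─ S) 𝒜
                       ⊆ᴿ[ VJ G C ─ S ] ⋃ᴿ G n (right ∘ f)
          π⊆⋃right = proj-⊆-⋃ (VJ G C ─ S) (VJ G (node B C) ─ S) c
                       (λ i y d r → proj₂ (∧-true⁻ (rel⊆join (f i) y d r)))
          ∑rcost≤k : ∑ (rcost ∘ f) ≤ k
          ∑rcost≤k = ℕ.≤-trans (∑-mono (λ i → ℕ.m≤n⊔m (lcost (f i)) (rcost (f i)))) b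

        ChiLe-inhabited⇒1≤ : ∀ A {𝒜 k x} → ChiLe G n tw A S 𝒜 k →
          Dom G n (VJ G A ─ S) x → 𝒜 x ≡ true → 1 ≤ k
        ChiLe-inhabited⇒1≤ (leaf l) χ d 𝒜x
          with CoverOf.covering-piece (leaf l) (toCover (leaf l) χ) d 𝒜x
        ... | _ , _ , 1≤k = 1≤k
        ChiLe-inhabited⇒1≤ (node B C) χ d 𝒜x
          with CoverOf.covering-piece (node B C) (toCover (node B C) χ) d 𝒜x
        ... | p , px , cost≤k =
          ℕ.≤-trans (ChiLe-inhabited⇒1≤ B (left-χ p) (Dom-mask (VJ─-⊆ˡ S B C) d) left-x)
                    (ℕ.≤-trans (ℕ.m≤m⊔n _ _) cost≤k)
          where
          open Junction
          left-x : left p (restrict G n (VJ G B ─ S) _) ≡ true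
          left-x = proj₁ (∧-true⁻ (rel⊆join p _ d px))

        ChiLe-proj-inhabited⇒1≤ : ∀ A U {𝒜 k x} → ChiLe G n tw A S 𝒜 k →
          proj G n U (VJ G A ─ S) 𝒜 x ≡ true → 1 ≤ k
        ChiLe-proj-inhabited⇒1≤ A U χ r with proj-witness U (VJ G A ─ S) r
        ... | _ , dy , 𝒜y , _ = ChiLe-inhabited⇒1≤ A χ dy 𝒜y

        ChiLe-⊥ : 1 ≤ n → ∀ {ℛ k} →
          (∀ x → Dom G n (VJ G (leaf nothing) ─ S) x → ℛ x ≡ true → 1 ≤ k) →
          ChiLe G n tw (leaf nothing) S ℛ k
        ChiLe-⊥ _   {k = zero}  inhabited⇒1≤0 =
          0 , z≤n , (λ ()) , (λ ()) , λ x d ℛx → contradiction (inhabited⇒1≤0 x d ℛx) λ ()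
        ChiLe-⊥ 1≤n {k = suc _} _ =
          1 , s≤s z≤n , (λ _ _ → true) , (λ _ → IsPathset-⊥ 1≤n S (λ _ → true)) ,
          λ _ _ _ → refl

lemma5p8 : (G : Graph) (tw : ThresholdWeighting G) (n : ℕ) → 1 ≤ n →
    (A : JT G) (S : Subset (Graph.v G)) (𝒜 : Rel G n) →
    ∀ (B : JT G) → _⪯_ G B A → ∀ (k : ℕ) →
    ChiLe G n tw A S 𝒜 k →
    ChiLe G n tw B S (proj G n (VJ G B ─ S) (VJ G A ─ S) 𝒜) k
lemma5p8 G tw n 1≤n A S 𝒜 _ ⪯⊥ k χ =
  ChiLe-⊥ G n tw S 1≤n
    (λ _ _ → ChiLe-proj-inhabited⇒1≤ G n tw S A (VJ G (leaf nothing) ─ S) χ)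
lemma5p8 G tw n _ A S 𝒜 _ ⪯refl k χ = ChiLe-⊆ G n tw S A (proj-⊆-self G n (VJ G A ─ S)) χ
lemma5p8 G tw n 1≤n (node B C) S 𝒜 D (⪯left D⪯B) k χ =
  ChiLe-⊆ G n tw S D (proj-∘ G n (VJ─-mono G S D⪯B) (VJ─-⊆ˡ G S B C))
    (lemma5p8 G tw n 1≤n B S _ D D⪯B k (ChiLe-projˡ G n tw S χ))
lemma5p8 G tw n 1≤n (node B C) S 𝒜 D (⪯right D⪯C) k χ =
  ChiLe-⊆ G n tw S D (proj-∘ G n (VJ─-mono G S D⪯C) (VJ─-⊆ʳ G S B C))
    (lemma5p8 G tw n 1≤n C S _ D D⪯C k (ChiLe-projʳ G n tw S χ))
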